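{- For every $n\in\mathbb{N}$, $F(n,x)=\dfrac{P_n(-x)}{P_{n+1}(x)}$. Consequently, for every positive integer $n$, $F(n,x)=\dfrac{1}{ -x+F(n-1,-x)}$.
   Context: For $n\in\mathbb{N}$, $P_n(x)=\sum_{k=0}^{n}(-1)^{\lfloor 3k/2\rfloor}\binom{\lfloor (n+k)/2\rfloor}{k}x^k$ (so $P_0=1$). For a positive integer $m$, $A_m$ is the $m\times m$ matrix with $(i,j)$ entry $1$ if $i+j\le m+1$ and $0$ otherwise, and $u_m=(1,\dots,1)^T\in\mathbb{R}^m$. For $n\in\mathbb{N}$, $F(n,x)=1+\sum_{k\ge 0}\left(u_{n+1}^TA_{n+1}^k u_{n+1}\right)x^{k+1}$, a formal power series in $x$. -}

module Defs where

open import Data.Nat as ℕ using (ℕ; zero; suc; _≤?_)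
open import Data.Nat.Combinatorics using (_C_)
open import Data.Nat.DivMod using (_/_)
open import Data.Fin using (Fin; toℕ) renaming (zero to fzero; suc to fsuc)
open import Data.Integer as ℤ using (ℤ; +_; -_; _*_; _+_; _-_; _^_; -1ℤ; 0ℤ; 1ℤ)
open import Relation.Nullary using (yes; no)

FPS : Set
FPS = ℕ → ℤ

sumFin : (m : ℕ) → (Fin m → ℤ) → ℤ
sumFin zero    f = 0ℤ
sumFin (suc m) f = f fzero + sumFin m (λ i → f (fsuc i))

sumTo : ℕ → (ℕ → ℤ) → ℤ
sumTo zero    f = f 0
sumTo (suc n) f = sumTo n f + f (suc n)

_⊛_ : FPS → FPS → FPS
(f ⊛ g) n = sumTo n (λ i → f i * g (n ℕ.∸ i))

oneS : FPS
oneS zero    = 1ℤ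
oneS (suc _) = 0ℤ

negX : FPS → FPS
negX f k = (-1ℤ ^ k) * f k

P : ℕ → FPS
P n k with k ≤? n
... | yes _ = (-1ℤ ^ ((3 ℕ.* k) / 2)) * (+ (((n ℕ.+ k) / 2) C k))
... | no  _ = 0ℤ

Mat : ℕ → Set
Mat m = Fin m → Fin m → ℤ

matMul : ∀ {m} → Mat m → Mat m → Mat m
matMul {m} X Y i j = sumFin m (λ l → X i l * Y l j)

identity : ∀ {m} → Mat m
identity i j with toℕ i ℕ.≟ toℕ j
... | yes _ = 1ℤ
... | no  _ = 0ℤ

matPow : ∀ {m} → Mat m → ℕ → Mat m
matPow X zero    = identity
matPow X (suc k) = matMul X (matPow X k)

-- A_m (1-indexed): entry (i,j) is 1 iff i + j ≤ m + 1
A : (m : ℕ) → Mat m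
A m i j with (suc (toℕ i) ℕ.+ suc (toℕ j)) ≤? suc m
... | yes _ = 1ℤ
... | no  _ = 0ℤ

uXu : ∀ {m} → Mat m → ℤ
uXu {m} X = sumFin m (λ i → sumFin m (λ j → X i j))

F : ℕ → FPS
F n zero    = 1ℤ
F n (suc k) = uXu (matPow (A (suc n)) k)

minusX+ : FPS → FPS
minusX+ f 1 = f 1 - 1ℤ
minusX+ f k = f k

-- Let G_i(x) = Σ_j (A^j u)_i x^j for A = A_{n+1}, rows indexed from 0. Row i of A has ones
-- exactly in the columns l ≤ n - i, so G_i = 1 + x Σ_{l ≤ n-i} G_l, and F(n,x) = 1 + x Σ_i G_i.
-- Extend P to negative indices by P_{-1-t}(x) = P_t(-x). Then Pascal's rule gives
-- P_j(x) = P_{j+2}(x) + x P_{-j-2}(x) for every j ∈ ℤ, and summing it shows that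
-- G_i = P_{2i-n-1} / P_{n+1} solves the same system; in particular F(n,x) = P_n(-x) / P_{n+1}(x).
-- The continued-fraction form follows by multiplying by P_{n+1}(-x) and using the recurrence once more.

module Submission where

open import Defs
open import Data.Nat as ℕ using (ℕ; zero; suc; _≤_; _<_; z≤n; s≤s; _∸_; _≤?_)
import Data.Nat.Properties as ℕₚ
open import Data.Nat.DivMod using (_/_; m/n≡1+[m∸n]/n; m/n*n≤m)
open import Data.Nat.Combinatorics using (_C_; nCk+nC[k+1]≡[n+1]C[k+1])
open import Data.Nat.Combinatorics.Specification using (k>n⇒nCk≡0)
open import Data.Fin using (Fin; toℕ) renaming (zero to fzero; suc to fsuc)
open import Data.Fin.Properties using (toℕ<n)
open import Data.Integer using (ℤ; +_; -[1+_]; -_; _*_; _+_; _-_; _^_; -1ℤ; 0ℤ; 1ℤ)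
import Data.Integer.Properties as ℤₚ
open import Algebra.Bundles using (AbelianGroup)
open import Algebra.Properties.Group (AbelianGroup.group ℤₚ.+-0-abelianGroup)
  using () renaming (∙-cancelˡ to +-cancelˡ)
open import Data.Integer.Tactic.RingSolver using (solve-∀)
open import Data.Product using (_×_; _,_)
open import Data.Empty using (⊥-elim)
open import Function using (_∘_)
open import Relation.Nullary using (¬_; yes; no)
open import Relation.Binary.PropositionalEquality

-- Finite sums

sumTo-cong : ∀ n {f g : ℕ → ℤ} → (∀ i → i ≤ n → f i ≡ g i) → sumTo n f ≡ sumTo n g
sumTo-cong zero    f≗g = f≗g 0 z≤n
sumTo-cong (suc n) f≗g =
  cong₂ _+_ (sumTo-cong n (λ i i≤n → f≗g i (ℕₚ.m≤n⇒m≤1+n i≤n))) (f≗g (suc n) ℕₚ.≤-refl)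

sumTo-suc : ∀ n (f : ℕ → ℤ) → sumTo (suc n) f ≡ f 0 + sumTo n (f ∘ suc)
sumTo-suc zero    f = refl
sumTo-suc (suc n) f =
  trans (cong (_+ f (suc (suc n))) (sumTo-suc n f)) (ℤₚ.+-assoc (f 0) _ _)

sumTo-+ : ∀ n (f g : ℕ → ℤ) → sumTo n (λ i → f i + g i) ≡ sumTo n f + sumTo n g
sumTo-+ zero    f g = refl
sumTo-+ (suc n) f g =
  trans (cong (_+ (f (suc n) + g (suc n))) (sumTo-+ n f g)) (+-interchange (sumTo n f) (sumTo n g) (f (suc n)) (g (suc n)))
  where
  +-interchange : ∀ a b c d → (a + b) + (c + d) ≡ (a + c) + (b + d)
  +-interchange = solve-∀

*-distribˡ-sumTo : ∀ n c (f : ℕ → ℤ) → c * sumTo n f ≡ sumTo n (λ i → c * f i)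
*-distribˡ-sumTo zero    c f = refl
*-distribˡ-sumTo (suc n) c f =
  trans (ℤₚ.*-distribˡ-+ c (sumTo n f) _) (cong (_+ c * f (suc n)) (*-distribˡ-sumTo n c f))

sumTo-zero : ∀ n → sumTo n (λ _ → 0ℤ) ≡ 0ℤ
sumTo-zero zero    = refl
sumTo-zero (suc n) = cong (_+ 0ℤ) (sumTo-zero n)

sumTo-reverse : ∀ n (f : ℕ → ℤ) → sumTo n f ≡ sumTo n (λ i → f (n ∸ i))
sumTo-reverse zero    f = refl
sumTo-reverse (suc n) f = begin
  sumTo n f + f (suc n)                      ≡⟨ cong (_+ f (suc n)) (sumTo-reverse n f) ⟩
  sumTo n (λ i → f (n ∸ i)) + f (suc n)      ≡⟨ ℤₚ.+-comm _ (f (suc n)) ⟩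
  f (suc n) + sumTo n (λ i → f (n ∸ i))      ≡⟨ sumTo-suc n (λ i → f (suc n ∸ i)) ⟨
  sumTo (suc n) (λ i → f (suc n ∸ i))        ∎
  where open ≡-Reasoning

sumTo-triangle : ∀ n (g : ℕ → ℕ → ℤ) →
  sumTo n (λ i → sumTo i (g i)) ≡ sumTo n (λ j → sumTo (n ∸ j) (λ l → g (j ℕ.+ l) j))
sumTo-triangle zero    g = refl
sumTo-triangle (suc n) g = begin
  sumTo n (λ i → sumTo i (g i)) + (sumTo n (g (suc n)) + g (suc n) (suc n))
    ≡⟨ cong (_+ (sumTo n (g (suc n)) + g (suc n) (suc n))) (sumTo-triangle n g) ⟩
  sumTo n (T n) + (sumTo n (g (suc n)) + g (suc n) (suc n))
    ≡⟨ ℤₚ.+-assoc (sumTo n (T n)) _ _ ⟨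
  (sumTo n (T n) + sumTo n (g (suc n))) + g (suc n) (suc n)
    ≡⟨ cong₂ _+_ (trans (sym (sumTo-+ n _ _)) (sumTo-cong n extend)) diagonal ⟩
  sumTo (suc n) (T (suc n)) ∎
  where
  open ≡-Reasoning
  T : ℕ → ℕ → ℤ
  T m j = sumTo (m ∸ j) (λ l → g (j ℕ.+ l) j)
  extend : ∀ j → j ≤ n → T n j + g (suc n) j ≡ T (suc n) j
  extend j j≤n rewrite ℕₚ.+-∸-assoc 1 j≤n =
    cong (λ x → T n j + g x j)
      (trans (cong suc (sym (ℕₚ.m+[n∸m]≡n j≤n))) (sym (ℕₚ.+-suc j (n ∸ j))))
  diagonal : g (suc n) (suc n) ≡ T (suc n) (suc n)
  diagonal rewrite ℕₚ.n∸n≡0 n | ℕₚ.+-identityʳ n = refl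

sumFin-cong : ∀ m {f g : Fin m → ℤ} → (∀ i → f i ≡ g i) → sumFin m f ≡ sumFin m g
sumFin-cong zero    f≗g = refl
sumFin-cong (suc m) f≗g = cong₂ _+_ (f≗g fzero) (sumFin-cong m (f≗g ∘ fsuc))

sumFin-+ : ∀ m (f g : Fin m → ℤ) → sumFin m (λ i → f i + g i) ≡ sumFin m f + sumFin m g
sumFin-+ zero    f g = refl
sumFin-+ (suc m) f g =
  trans (cong (_+_ (f fzero + g fzero)) (sumFin-+ m (f ∘ fsuc) (g ∘ fsuc)))
        (+-interchange (f fzero) (g fzero) (sumFin m (f ∘ fsuc)) (sumFin m (g ∘ fsuc)))
  where
  +-interchange : ∀ a b c d → (a + b) + (c + d) ≡ (a + c) + (b + d)
  +-interchange = solve-∀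

*-distribˡ-sumFin : ∀ m c (f : Fin m → ℤ) → c * sumFin m f ≡ sumFin m (λ i → c * f i)
*-distribˡ-sumFin zero    c f = ℤₚ.*-zeroʳ c
*-distribˡ-sumFin (suc m) c f =
  trans (ℤₚ.*-distribˡ-+ c (f fzero) _) (cong (_+_ (c * f fzero)) (*-distribˡ-sumFin m c (f ∘ fsuc)))

*-distribʳ-sumFin : ∀ m c (f : Fin m → ℤ) → sumFin m f * c ≡ sumFin m (λ i → f i * c)
*-distribʳ-sumFin m c f =
  trans (ℤₚ.*-comm (sumFin m f) c)
        (trans (*-distribˡ-sumFin m c f) (sumFin-cong m (λ i → ℤₚ.*-comm c (f i))))

sumFin-zero : ∀ m → sumFin m (λ _ → 0ℤ) ≡ 0ℤ
sumFin-zero zero    = refl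
sumFin-zero (suc m) = trans (ℤₚ.+-identityˡ _) (sumFin-zero m)

sumFin-comm : ∀ m m′ (f : Fin m → Fin m′ → ℤ) →
  sumFin m (λ i → sumFin m′ (f i)) ≡ sumFin m′ (λ j → sumFin m (λ i → f i j))
sumFin-comm zero    m′ f = sym (sumFin-zero m′)
sumFin-comm (suc m) m′ f =
  trans (cong (_+_ (sumFin m′ (f fzero))) (sumFin-comm m m′ (f ∘ fsuc)))
        (sym (sumFin-+ m′ (f fzero) (λ j → sumFin m (λ i → f (fsuc i) j))))

sumTo-sumFin-comm : ∀ n m (f : ℕ → Fin m → ℤ) →
  sumTo n (λ i → sumFin m (f i)) ≡ sumFin m (λ j → sumTo n (λ i → f i j))
sumTo-sumFin-comm zero    m f = refl
sumTo-sumFin-comm (suc n) m f =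
  trans (cong (_+ sumFin m (f (suc n))) (sumTo-sumFin-comm n m f))
        (sym (sumFin-+ m (λ j → sumTo n (λ i → f i j)) (f (suc n))))

sumFin-single : ∀ m (f : Fin m → ℤ) i → (∀ j → toℕ j ≢ toℕ i → f j ≡ 0ℤ) → sumFin m f ≡ f i
sumFin-single (suc m) f fzero f≡0 =
  trans (cong (_+_ (f fzero)) (trans (sumFin-cong m (λ j → f≡0 (fsuc j) (λ ()))) (sumFin-zero m)))
        (ℤₚ.+-identityʳ _)
sumFin-single (suc m) f (fsuc i) f≡0 =
  trans (cong (_+ sumFin m (f ∘ fsuc)) (f≡0 fzero (λ ())))
        (trans (ℤₚ.+-identityˡ _) (sumFin-single m (f ∘ fsuc) i (λ j j≢i → f≡0 (fsuc j) (j≢i ∘ ℕₚ.suc-injective))))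

sumBelow : ℕ → (ℕ → ℤ) → ℤ
sumBelow zero    q = 0ℤ
sumBelow (suc t) q = q 0 + sumBelow t (q ∘ suc)

sumBelow-suc : ∀ t q → sumBelow (suc t) q ≡ sumBelow t q + q t
sumBelow-suc zero    q = trans (ℤₚ.+-identityʳ (q 0)) (sym (ℤₚ.+-identityˡ (q 0)))
sumBelow-suc (suc t) q =
  trans (cong (_+_ (q 0)) (sumBelow-suc t (q ∘ suc))) (sym (ℤₚ.+-assoc (q 0) _ _))

sumFin-truncate : ∀ m t (f : Fin m → ℤ) (q : ℕ → ℤ) → t ≤ m →
  (∀ j → toℕ j < t → f j ≡ q (toℕ j)) → (∀ j → t ≤ toℕ j → f j ≡ 0ℤ) →
  sumFin m f ≡ sumBelow t q
sumFin-truncate zero    zero    f q _ _ _ = refl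
sumFin-truncate (suc m) zero    f q _ _ f≡0 =
  trans (cong₂ _+_ (f≡0 fzero z≤n) (sumFin-truncate m zero (f ∘ fsuc) q z≤n (λ _ ()) (λ j _ → f≡0 (fsuc j) z≤n)))
        (ℤₚ.+-identityˡ _)
sumFin-truncate (suc m) (suc t) f q (s≤s t≤m) f≡q f≡0 =
  cong₂ _+_ (f≡q fzero (s≤s z≤n))
    (sumFin-truncate m t (f ∘ fsuc) (q ∘ suc) t≤m (λ j j<t → f≡q (fsuc j) (s≤s j<t))
                                                 (λ j t≤j → f≡0 (fsuc j) (s≤s t≤j)))

-- Formal power series

infix 4 _≈_
_≈_ : FPS → FPS → Set
f ≈ g = ∀ k → f k ≡ g k

_⊖_ : FPS → FPS → FPS
(f ⊖ g) k = f k - g k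

X : FPS
X 1 = 1ℤ
X _ = 0ℤ

⊛-congˡ : ∀ {a a′} b → a ≈ a′ → a ⊛ b ≈ a′ ⊛ b
⊛-congˡ b a≈a′ k = sumTo-cong k (λ i _ → cong (_* b (k ∸ i)) (a≈a′ i))

⊛-congʳ : ∀ a {b b′} → b ≈ b′ → a ⊛ b ≈ a ⊛ b′
⊛-congʳ a b≈b′ k = sumTo-cong k (λ i _ → cong (a i *_) (b≈b′ (k ∸ i)))

⊛-comm : ∀ a b → a ⊛ b ≈ b ⊛ a
⊛-comm a b k = trans (sumTo-reverse k _) (sumTo-cong k λ i i≤k →
  trans (cong (λ j → a (k ∸ i) * b j) (ℕₚ.m∸[m∸n]≡n i≤k)) (ℤₚ.*-comm (a (k ∸ i)) (b i)))

⊛-assoc : ∀ a b c → (a ⊛ b) ⊛ c ≈ a ⊛ (b ⊛ c)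
⊛-assoc a b c n = begin
  sumTo n (λ i → sumTo i (λ j → a j * b (i ∸ j)) * c (n ∸ i))
    ≡⟨ sumTo-cong n (λ i _ → trans (ℤₚ.*-comm _ (c (n ∸ i))) (*-distribˡ-sumTo i (c (n ∸ i)) _)) ⟩
  sumTo n (λ i → sumTo i (λ j → c (n ∸ i) * (a j * b (i ∸ j))))
    ≡⟨ sumTo-triangle n _ ⟩
  sumTo n (λ j → sumTo (n ∸ j) (λ l → c (n ∸ (j ℕ.+ l)) * (a j * b ((j ℕ.+ l) ∸ j))))
    ≡⟨ sumTo-cong n (λ j _ → trans (sumTo-cong (n ∸ j) (λ l _ → reindex j l))
                                   (sym (*-distribˡ-sumTo (n ∸ j) (a j) _))) ⟩
  sumTo n (λ j → a j * sumTo (n ∸ j) (λ l → b l * c (n ∸ j ∸ l))) ∎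
  where
  open ≡-Reasoning
  rotate : ∀ x y z → z * (x * y) ≡ x * (y * z)
  rotate = solve-∀
  reindex : ∀ j l → c (n ∸ (j ℕ.+ l)) * (a j * b ((j ℕ.+ l) ∸ j)) ≡ a j * (b l * c (n ∸ j ∸ l))
  reindex j l rewrite ℕₚ.m+n∸m≡n j l | ℕₚ.∸-+-assoc n j l = rotate (a j) (b l) _

⊛-identityʳ : ∀ a → a ⊛ oneS ≈ a
⊛-identityʳ a zero    = ℤₚ.*-identityʳ (a 0)
⊛-identityʳ a (suc k) = begin
  sumTo k (λ i → a i * oneS (suc k ∸ i)) + a (suc k) * oneS (k ∸ k)
    ≡⟨ cong₂ _+_ (trans (sumTo-cong k below) (sumTo-zero k)) diagonal ⟩
  0ℤ + a (suc k)
    ≡⟨ ℤₚ.+-identityˡ _ ⟩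
  a (suc k) ∎
  where
  open ≡-Reasoning
  below : ∀ i → i ≤ k → a i * oneS (suc k ∸ i) ≡ 0ℤ
  below i i≤k = trans (cong (λ j → a i * oneS j) (ℕₚ.+-∸-assoc 1 i≤k)) (ℤₚ.*-zeroʳ (a i))
  diagonal : a (suc k) * oneS (k ∸ k) ≡ a (suc k)
  diagonal = trans (cong (λ j → a (suc k) * oneS j) (ℕₚ.n∸n≡0 k)) (ℤₚ.*-identityʳ (a (suc k)))

sumTo-oneS : ∀ k (d : ℕ → ℤ) → sumTo k (λ i → oneS i * d i) ≡ d 0
sumTo-oneS zero    d = ℤₚ.*-identityˡ (d 0)
sumTo-oneS (suc k) d = begin
  sumTo (suc k) (λ i → oneS i * d i)
    ≡⟨ sumTo-suc k _ ⟩
  1ℤ * d 0 + sumTo k (λ i → 0ℤ * d (suc i))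
    ≡⟨ cong₂ _+_ (ℤₚ.*-identityˡ (d 0)) (trans (sumTo-cong k (λ i _ → ℤₚ.*-zeroˡ (d (suc i)))) (sumTo-zero k)) ⟩
  d 0 + 0ℤ
    ≡⟨ ℤₚ.+-identityʳ _ ⟩
  d 0 ∎
  where open ≡-Reasoning

⊛-distribˡ-⊖ : ∀ a b c → a ⊛ (b ⊖ c) ≈ (a ⊛ b) ⊖ (a ⊛ c)
⊛-distribˡ-⊖ a b c k = begin
  sumTo k (λ i → a i * (b (k ∸ i) - c (k ∸ i)))
    ≡⟨ sumTo-cong k (λ i _ → expand (a i) _ _) ⟩
  sumTo k (λ i → a i * b (k ∸ i) + -1ℤ * (a i * c (k ∸ i)))
    ≡⟨ sumTo-+ k _ _ ⟩
  (a ⊛ b) k + sumTo k (λ i → -1ℤ * (a i * c (k ∸ i)))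
    ≡⟨ cong (_+_ ((a ⊛ b) k)) (sym (*-distribˡ-sumTo k -1ℤ _)) ⟩
  (a ⊛ b) k + -1ℤ * (a ⊛ c) k
    ≡⟨ cong (_+_ ((a ⊛ b) k)) (ℤₚ.-1*i≡-i _) ⟩
  (a ⊛ b) k - (a ⊛ c) k ∎
  where
  open ≡-Reasoning
  expand : ∀ x y z → x * (y - z) ≡ x * y + -1ℤ * (x * z)
  expand = solve-∀

⊛-X-zero : ∀ a → (a ⊛ X) 0 ≡ 0ℤ
⊛-X-zero a = ℤₚ.*-zeroʳ (a 0)

⊛-X-suc : ∀ a k → (a ⊛ X) (suc k) ≡ a k
⊛-X-suc a k = begin
  sumTo k (λ i → a i * X (suc k ∸ i)) + a (suc k) * X (k ∸ k)
    ≡⟨ cong₂ _+_ (sumTo-cong k shift) (trans (cong (λ j → a (suc k) * X j) (ℕₚ.n∸n≡0 k))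
                                              (ℤₚ.*-zeroʳ (a (suc k)))) ⟩
  (a ⊛ oneS) k + 0ℤ
    ≡⟨ ℤₚ.+-identityʳ _ ⟩
  (a ⊛ oneS) k
    ≡⟨ ⊛-identityʳ a k ⟩
  a k ∎
  where
  open ≡-Reasoning
  X-suc : ∀ j → X (suc j) ≡ oneS j
  X-suc zero    = refl
  X-suc (suc j) = refl
  shift : ∀ i → i ≤ k → a i * X (suc k ∸ i) ≡ a i * oneS (k ∸ i)
  shift i i≤k = cong (a i *_) (trans (cong X (ℕₚ.+-∸-assoc 1 i≤k)) (X-suc (k ∸ i)))

minusX+≈⊖X : ∀ f → minusX+ f ≈ f ⊖ X
minusX+≈⊖X f zero          = sym (ℤₚ.+-identityʳ (f 0))
minusX+≈⊖X f (suc zero)    = refl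
minusX+≈⊖X f (suc (suc k)) = sym (ℤₚ.+-identityʳ _)

-1^k*-1^k≡1 : ∀ k → -1ℤ ^ k * -1ℤ ^ k ≡ 1ℤ
-1^k*-1^k≡1 zero    = refl
-1^k*-1^k≡1 (suc k) = trans (-1*x*-1*x≡x*x (-1ℤ ^ k)) (-1^k*-1^k≡1 k)
  where
  -1*x*-1*x≡x*x : ∀ x → -1ℤ * x * (-1ℤ * x) ≡ x * x
  -1*x*-1*x≡x*x = solve-∀

negX-⊛ : ∀ a b → negX (a ⊛ b) ≈ negX a ⊛ negX b
negX-⊛ a b k = trans (*-distribˡ-sumTo k (-1ℤ ^ k) _) (sumTo-cong k split-sign)
  where
  interchange : ∀ s t x y → (s * t) * (x * y) ≡ (s * x) * (t * y)
  interchange = solve-∀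
  split-sign : ∀ i → i ≤ k →
    -1ℤ ^ k * (a i * b (k ∸ i)) ≡ (-1ℤ ^ i * a i) * (-1ℤ ^ (k ∸ i) * b (k ∸ i))
  split-sign i i≤k = begin
    -1ℤ ^ k * (a i * b (k ∸ i))
      ≡⟨ cong (λ j → -1ℤ ^ j * (a i * b (k ∸ i))) (sym (ℕₚ.m+[n∸m]≡n i≤k)) ⟩
    -1ℤ ^ (i ℕ.+ (k ∸ i)) * (a i * b (k ∸ i))
      ≡⟨ cong (_* (a i * b (k ∸ i))) (ℤₚ.^-distribˡ-+-* -1ℤ i (k ∸ i)) ⟩
    (-1ℤ ^ i * -1ℤ ^ (k ∸ i)) * (a i * b (k ∸ i))
      ≡⟨ interchange (-1ℤ ^ i) (-1ℤ ^ (k ∸ i)) (a i) (b (k ∸ i)) ⟩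
    (-1ℤ ^ i * a i) * (-1ℤ ^ (k ∸ i) * b (k ∸ i)) ∎
    where open ≡-Reasoning

negX-involutive : ∀ a → negX (negX a) ≈ a
negX-involutive a k = begin
  -1ℤ ^ k * (-1ℤ ^ k * a k)  ≡⟨ ℤₚ.*-assoc (-1ℤ ^ k) (-1ℤ ^ k) (a k) ⟨
  -1ℤ ^ k * -1ℤ ^ k * a k    ≡⟨ cong (_* a k) (-1^k*-1^k≡1 k) ⟩
  1ℤ * a k                   ≡⟨ ℤₚ.*-identityˡ (a k) ⟩
  a k                        ∎
  where open ≡-Reasoning

-- Comparing coefficients of e·c = c degree by degree, using c₀ = 1.
⊛-idempotent⇒oneS : ∀ {c e} → c 0 ≡ 1ℤ → c ⊛ e ≈ c → e ≈ oneS
⊛-idempotent⇒oneS {c} {e} c₀≡1 ce≈c k = up-to k k ℕₚ.≤-refl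
  where
  ec≈c : e ⊛ c ≈ c
  ec≈c k = trans (⊛-comm e c k) (ce≈c k)
  up-to : ∀ n j → j ≤ n → e j ≡ oneS j
  up-to n zero _ =
    trans (sym (ℤₚ.*-identityʳ (e 0))) (trans (cong (e 0 *_) (sym c₀≡1)) (trans (ec≈c 0) c₀≡1))
  up-to (suc n) (suc j) (s≤s j≤n) = +-cancelˡ (c (suc j)) (e (suc j)) 0ℤ top-coefficient
    where
    lower : sumTo j (λ i → e i * c (suc j ∸ i)) ≡ c (suc j)
    lower = trans (sumTo-cong j (λ i i≤j → cong (_* c (suc j ∸ i)) (up-to n i (ℕₚ.≤-trans i≤j j≤n))))
                  (sumTo-oneS j (λ i → c (suc j ∸ i)))
    top : e (suc j) * c (j ∸ j) ≡ e (suc j)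
    top = trans (cong (λ i → e (suc j) * c i) (ℕₚ.n∸n≡0 j))
                (trans (cong (e (suc j) *_) c₀≡1) (ℤₚ.*-identityʳ _))
    top-coefficient : c (suc j) + e (suc j) ≡ c (suc j) + 0ℤ
    top-coefficient = trans (cong₂ _+_ (sym lower) (sym top))
                            (trans (ec≈c (suc j)) (sym (ℤₚ.+-identityʳ _)))

-- The polynomials P_n

sign : ℕ → ℤ
sign k = -1ℤ ^ ((3 ℕ.* k) / 2)

[2+n]/2≡1+n/2 : ∀ n → suc (suc n) / 2 ≡ suc (n / 2)
[2+n]/2≡1+n/2 n = m/n≡1+[m∸n]/n {suc (suc n)} {2} (s≤s (s≤s z≤n))

m<n⇒[m+n]/2<n : ∀ {m n} → m < n → (m ℕ.+ n) / 2 < n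
m<n⇒[m+n]/2<n {m} {n} m<n = ℕₚ.*-cancelʳ-< 2 ((m ℕ.+ n) / 2) n
  (ℕₚ.≤-<-trans (m/n*n≤m (m ℕ.+ n) 2)
    (subst ((m ℕ.+ n) <_) (trans (cong (n ℕ.+_) (sym (ℕₚ.+-identityʳ n))) (ℕₚ.*-comm 2 n))
           (ℕₚ.+-monoˡ-< n m<n)))

-- The truncation k ≤ n in the definition of P is automatic: the binomial vanishes for k > n.
P-coefficient : ∀ n k → P n k ≡ sign k * + (((n ℕ.+ k) / 2) C k)
P-coefficient n k with k ≤? n
... | yes _   = refl
... | no  k≰n = sym (trans (cong (λ b → sign k * + b) (k>n⇒nCk≡0 (m<n⇒[m+n]/2<n (ℕₚ.≰⇒> k≰n))))
                           (ℤₚ.*-zeroʳ (sign k)))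

P-vanishes : ∀ n k → n < k → P n k ≡ 0ℤ
P-vanishes n k n<k with k ≤? n
... | yes k≤n = ⊥-elim (ℕₚ.<⇒≱ n<k k≤n)
... | no  _   = refl

sign-+2 : ∀ k → sign (suc (suc k)) ≡ - sign k
sign-+2 k = begin
  -1ℤ ^ ((3 ℕ.* suc (suc k)) / 2)
    ≡⟨ cong (λ j → -1ℤ ^ (j / 2)) 3[2+k]≡6+3k ⟩
  -1ℤ ^ ((suc (suc (suc (suc (suc (suc (3 ℕ.* k))))))) / 2)
    ≡⟨ cong (-1ℤ ^_) (trans ([2+n]/2≡1+n/2 (suc (suc (suc (suc (3 ℕ.* k))))))
                      (cong suc (trans ([2+n]/2≡1+n/2 (suc (suc (3 ℕ.* k))))
                                       (cong suc ([2+n]/2≡1+n/2 (3 ℕ.* k)))))) ⟩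
  -1ℤ * (-1ℤ * (-1ℤ * sign k))
    ≡⟨ cube (sign k) ⟩
  - sign k ∎
  where
  open ≡-Reasoning
  cube : ∀ x → -1ℤ * (-1ℤ * (-1ℤ * x)) ≡ - x
  cube = solve-∀
  3[2+k]≡6+3k : 3 ℕ.* suc (suc k) ≡ suc (suc (suc (suc (suc (suc (3 ℕ.* k))))))
  3[2+k]≡6+3k = trans (ℕₚ.*-suc 3 (suc k)) (cong (3 ℕ.+_) (ℕₚ.*-suc 3 k))

sign-suc : ∀ k → sign (suc k) ≡ - (-1ℤ ^ k * sign k)
sign-suc zero          = refl
sign-suc (suc zero)    = refl
sign-suc (suc (suc k)) = begin
  sign (suc (suc (suc k)))
    ≡⟨ sign-+2 (suc k) ⟩
  - sign (suc k)
    ≡⟨ cong -_ (sign-suc k) ⟩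
  - (- (-1ℤ ^ k * sign k))
    ≡⟨ rearrange (-1ℤ ^ k) (sign k) ⟩
  - ((-1ℤ * (-1ℤ * -1ℤ ^ k)) * - sign k)
    ≡⟨ cong (λ s → - ((-1ℤ * (-1ℤ * -1ℤ ^ k)) * s)) (sym (sign-+2 k)) ⟩
  - (-1ℤ ^ suc (suc k) * sign (suc (suc k))) ∎
  where
  open ≡-Reasoning
  rearrange : ∀ u v → - (- (u * v)) ≡ - ((-1ℤ * (-1ℤ * u)) * - v)
  rearrange = solve-∀

-- P_{n+2}(x) = P_n(x) - x P_{n+1}(-x), from Pascal's rule.
P-recurrence : ∀ n k → P (suc (suc n)) (suc k) ≡ P n (suc k) - -1ℤ ^ k * P (suc n) k
P-recurrence n k = begin
  P (suc (suc n)) (suc k)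
    ≡⟨ P-coefficient (suc (suc n)) (suc k) ⟩
  sign (suc k) * + ((suc (suc (n ℕ.+ suc k)) / 2) C suc k)
    ≡⟨ cong (λ j → sign (suc k) * + (j C suc k)) ([2+n]/2≡1+n/2 (n ℕ.+ suc k)) ⟩
  sign (suc k) * + (suc h C suc k)
    ≡⟨ cong (λ b → sign (suc k) * + b) (sym (nCk+nC[k+1]≡[n+1]C[k+1] h k)) ⟩
  sign (suc k) * + (h C k ℕ.+ h C suc k)
    ≡⟨ cong (sign (suc k) *_) (ℤₚ.pos-+ (h C k) (h C suc k)) ⟩
  sign (suc k) * (+ (h C k) + + (h C suc k))
    ≡⟨ cong (_* (+ (h C k) + + (h C suc k))) (sign-suc k) ⟩
  - (-1ℤ ^ k * sign k) * (+ (h C k) + + (h C suc k))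
    ≡⟨ distribute (-1ℤ ^ k) (sign k) (+ (h C k)) (+ (h C suc k)) ⟩
  - (-1ℤ ^ k * sign k) * + (h C suc k) - -1ℤ ^ k * (sign k * + (h C k))
    ≡⟨ cong₂ (λ s j → s * + (h C suc k) - -1ℤ ^ k * (sign k * + ((j / 2) C k)))
             (sym (sign-suc k)) (ℕₚ.+-suc n k) ⟩
  sign (suc k) * + (h C suc k) - -1ℤ ^ k * (sign k * + (((suc n ℕ.+ k) / 2) C k))
    ≡⟨ cong₂ (λ x y → x - -1ℤ ^ k * y) (sym (P-coefficient n (suc k))) (sym (P-coefficient (suc n) k)) ⟩
  P n (suc k) - -1ℤ ^ k * P (suc n) k ∎
  where
  open ≡-Reasoning
  h = (n ℕ.+ suc k) / 2
  distribute : ∀ u v x y → - (u * v) * (x + y) ≡ - (u * v) * y - u * (v * x)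
  distribute = solve-∀

Pℤ : ℤ → FPS
Pℤ (+ n)    = P n
Pℤ -[1+ t ] = negX (P t)

Pℤ-constant : ∀ j → Pℤ j 0 ≡ 1ℤ
Pℤ-constant (+ _)    = refl
Pℤ-constant -[1+ _ ] = refl

Pℤ-recurrence : ∀ j k → Pℤ j (suc k) ≡ Pℤ (j + + 2) (suc k) + Pℤ (- j - + 2) k
Pℤ-recurrence (+ n) k = begin
  P n (suc k)
    ≡⟨ sub-add (P n (suc k)) _ ⟩
  (P n (suc k) - -1ℤ ^ k * P (suc n) k) + -1ℤ ^ k * P (suc n) k
    ≡⟨ cong (_+ -1ℤ ^ k * P (suc n) k) (sym (P-recurrence n k)) ⟩
  P (suc (suc n)) (suc k) + negX (P (suc n)) k
    ≡⟨ cong₂ (λ i j → P i (suc k) + Pℤ j k) (ℕₚ.+-comm 2 n) -[2+n]≡-n-2 ⟩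
  Pℤ (+ n + + 2) (suc k) + Pℤ (- + n - + 2) k ∎
  where
  open ≡-Reasoning
  sub-add : ∀ x y → x ≡ (x - y) + y
  sub-add = solve-∀
  neg-+ : ∀ x y → - (x + y) ≡ - y - x
  neg-+ = solve-∀
  -[2+n]≡-n-2 : -[1+ suc n ] ≡ - + n - + 2
  -[2+n]≡-n-2 = trans (cong -_ (ℤₚ.pos-+ 2 n)) (neg-+ (+ 2) (+ n))
Pℤ-recurrence -[1+ zero ] zero = refl
Pℤ-recurrence -[1+ zero ] (suc k)
  rewrite P-vanishes 0 (suc (suc k)) (s≤s z≤n) | P-vanishes 1 (suc (suc k)) (s≤s (s≤s z≤n))
        | P-vanishes 0 (suc k) (s≤s z≤n)
  = trans (ℤₚ.*-zeroʳ (-1ℤ ^ suc (suc k))) (sym (trans (ℤₚ.+-identityˡ _) (ℤₚ.*-zeroʳ (-1ℤ ^ suc k))))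
Pℤ-recurrence -[1+ suc zero ] zero = refl
Pℤ-recurrence -[1+ suc zero ] (suc k)
  rewrite P-vanishes 0 (suc (suc k)) (s≤s z≤n) | P-vanishes 1 (suc (suc k)) (s≤s (s≤s z≤n))
        | P-vanishes 0 (suc k) (s≤s z≤n)
  = ℤₚ.*-zeroʳ (-1ℤ ^ suc (suc k))
Pℤ-recurrence -[1+ suc (suc t) ] k = begin
  -1ℤ ^ suc k * P (suc (suc t)) (suc k)
    ≡⟨ cong (-1ℤ ^ suc k *_) (P-recurrence t k) ⟩
  -1ℤ * u * (P t (suc k) - u * P (suc t) k)
    ≡⟨ expand u (P t (suc k)) (P (suc t) k) ⟩
  -1ℤ * u * P t (suc k) + (u * u) * P (suc t) k
    ≡⟨ cong (λ s → -1ℤ * u * P t (suc k) + s * P (suc t) k) (-1^k*-1^k≡1 k) ⟩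
  -1ℤ * u * P t (suc k) + 1ℤ * P (suc t) k
    ≡⟨ cong (_+_ (-1ℤ * u * P t (suc k))) (ℤₚ.*-identityˡ _) ⟩
  -1ℤ * u * P t (suc k) + P (suc t) k ∎
  where
  open ≡-Reasoning
  u = -1ℤ ^ k
  expand : ∀ u x y → -1ℤ * u * (x - u * y) ≡ -1ℤ * u * x + (u * u) * y
  expand = solve-∀

-- 2c - m: the index j for which row c (from 0) of A_m has generating function P_j / P_m.
level : ℕ → ℕ → ℤ
level m c = (+ c + + c) - + m

level-self : ∀ m → level m m ≡ + m
level-self m = 2x-x≡x (+ m)
  where
  2x-x≡x : ∀ x → (x + x) - x ≡ x
  2x-x≡x = solve-∀

level-suc : ∀ m s → level m s + + 2 ≡ level m (suc s)
level-suc m s = begin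
  (+ s + + s) - + m + + 2               ≡⟨ shift (+ s) (+ m) ⟩
  ((+ 1 + + s) + (+ 1 + + s)) - + m     ≡⟨ cong (λ x → (x + x) - + m) (sym (ℤₚ.pos-+ 1 s)) ⟩
  level m (suc s)                       ∎
  where
  open ≡-Reasoning
  shift : ∀ s m → (s + s) - m + + 2 ≡ ((+ 1 + s) + (+ 1 + s)) - m
  shift = solve-∀

level-reflect : ∀ {m} t s → t ℕ.+ suc s ≡ m → - level m s - + 2 ≡ level m t
level-reflect t s refl = begin
  - ((+ s + + s) - + (t ℕ.+ suc s)) - + 2       ≡⟨ cong (λ x → - ((+ s + + s) - x) - + 2) m≡t+1+s ⟩
  - ((+ s + + s) - (+ t + (+ 1 + + s))) - + 2   ≡⟨ reflect (+ s) (+ t) ⟩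
  (+ t + + t) - (+ t + (+ 1 + + s))             ≡⟨ cong (λ x → (+ t + + t) - x) m≡t+1+s ⟨
  level (t ℕ.+ suc s) t                         ∎
  where
  open ≡-Reasoning
  m≡t+1+s : + (t ℕ.+ suc s) ≡ + t + (+ 1 + + s)
  m≡t+1+s = trans (ℤₚ.pos-+ t (suc s)) (cong (_+_ (+ t)) (ℤₚ.pos-+ 1 s))
  reflect : ∀ s t → - ((s + s) - (t + (+ 1 + s))) - + 2 ≡ (t + t) - (t + (+ 1 + s))
  reflect = solve-∀

P-telescope : ∀ {m} t s k → t ℕ.+ s ≡ m →
  P m (suc k) + sumBelow t (λ c → Pℤ (level m c) k) ≡ Pℤ (level m s) (suc k)
P-telescope zero s k refl =
  trans (ℤₚ.+-identityʳ _) (cong (λ j → Pℤ j (suc k)) (sym (level-self s)))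
P-telescope {m} (suc t) s k t+s≡m = begin
  P m (suc k) + sumBelow (suc t) q
    ≡⟨ cong (_+_ (P m (suc k))) (sumBelow-suc t q) ⟩
  P m (suc k) + (sumBelow t q + q t)
    ≡⟨ ℤₚ.+-assoc (P m (suc k)) _ _ ⟨
  (P m (suc k) + sumBelow t q) + q t
    ≡⟨ cong (_+ q t) (P-telescope t (suc s) k t+[1+s]≡m) ⟩
  Pℤ (level m (suc s)) (suc k) + Pℤ (level m t) k
    ≡⟨ cong₂ (λ i j → Pℤ i (suc k) + Pℤ j k) (sym (level-suc m s)) (sym (level-reflect t s t+[1+s]≡m)) ⟩
  Pℤ (level m s + + 2) (suc k) + Pℤ (- level m s - + 2) k
    ≡⟨ Pℤ-recurrence (level m s) k ⟨
  Pℤ (level m s) (suc k) ∎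
  where
  open ≡-Reasoning
  q : ℕ → ℤ
  q c = Pℤ (level m c) k
  t+[1+s]≡m : t ℕ.+ suc s ≡ m
  t+[1+s]≡m = trans (ℕₚ.+-suc t s) t+s≡m

rowSums : ∀ m → Fin m → FPS
rowSums m i j = sumFin m (matPow (A m) j i)

rowSums-zero : ∀ m i → rowSums m i 0 ≡ 1ℤ
rowSums-zero m i = trans (sumFin-single m (identity i) i off-diagonal) diagonal
  where
  off-diagonal : ∀ j → toℕ j ≢ toℕ i → identity i j ≡ 0ℤ
  off-diagonal j j≢i with toℕ i ℕ.≟ toℕ j
  ... | yes i≡j = ⊥-elim (j≢i (sym i≡j))
  ... | no  _   = refl
  diagonal : identity i i ≡ 1ℤ
  diagonal with toℕ i ℕ.≟ toℕ i
  ... | yes _   = refl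
  ... | no  i≢i = ⊥-elim (i≢i refl)

rowSums-suc : ∀ m i j → rowSums m i (suc j) ≡ sumFin m (λ l → A m i l * rowSums m l j)
rowSums-suc m i j =
  trans (sumFin-comm m m (λ c l → A m i l * matPow (A m) j l c))
        (sumFin-cong m (λ l → sym (*-distribˡ-sumFin m (A m i l) (matPow (A m) j l))))

A-inside : ∀ n (i j : Fin (suc n)) → toℕ i ℕ.+ toℕ j ≤ n → A (suc n) i j ≡ 1ℤ
A-inside n i j i+j≤n with (suc (toℕ i) ℕ.+ suc (toℕ j)) ≤? suc (suc n)
... | yes _ = refl
... | no  ≰ = ⊥-elim (≰ (s≤s (subst (_≤ suc n) (sym (ℕₚ.+-suc (toℕ i) (toℕ j))) (s≤s i+j≤n))))

A-outside : ∀ n (i j : Fin (suc n)) → ¬ (toℕ i ℕ.+ toℕ j ≤ n) → A (suc n) i j ≡ 0ℤ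
A-outside n i j i+j≰n with (suc (toℕ i) ℕ.+ suc (toℕ j)) ≤? suc (suc n)
... | no  _         = refl
... | yes (s≤s ≤2+n) =
  ⊥-elim (i+j≰n (ℕₚ.≤-pred (subst (_≤ suc n) (ℕₚ.+-suc (toℕ i) (toℕ j)) ≤2+n)))

sumFin-A-row : ∀ n (i : Fin (suc n)) (q : ℕ → ℤ) →
  sumFin (suc n) (λ l → A (suc n) i l * q (toℕ l)) ≡ sumBelow (suc (n ∸ toℕ i)) q
sumFin-A-row n i q =
  sumFin-truncate (suc n) (suc (n ∸ toℕ i)) _ q (s≤s (ℕₚ.m∸n≤m n (toℕ i))) inside outside
  where
  i≤n : toℕ i ≤ n
  i≤n = ℕₚ.≤-pred (toℕ<n i)
  i+l≤n⇒l≤n∸i : ∀ l → toℕ i ℕ.+ l ≤ n → l ≤ n ∸ toℕ i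
  i+l≤n⇒l≤n∸i l i+l≤n = ℕₚ.m+n≤o⇒m≤o∸n l (subst (_≤ n) (ℕₚ.+-comm (toℕ i) l) i+l≤n)
  inside : ∀ l → toℕ l < suc (n ∸ toℕ i) → A (suc n) i l * q (toℕ l) ≡ q (toℕ l)
  inside l (s≤s l≤n∸i) =
    trans (cong (_* q (toℕ l)) (A-inside n i l i+l≤n)) (ℤₚ.*-identityˡ (q (toℕ l)))
    where
    i+l≤n : toℕ i ℕ.+ toℕ l ≤ n
    i+l≤n = subst (_≤ n) (ℕₚ.+-comm (toℕ l) (toℕ i)) (ℕₚ.m≤o∸n⇒m+n≤o (toℕ l) i≤n l≤n∸i)
  outside : ∀ l → suc (n ∸ toℕ i) ≤ toℕ l → A (suc n) i l * q (toℕ l) ≡ 0ℤ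
  outside l n∸i<l =
    trans (cong (_* q (toℕ l)) (A-outside n i l (ℕₚ.<⇒≱ n∸i<l ∘ i+l≤n⇒l≤n∸i (toℕ l))))
          (ℤₚ.*-zeroˡ (q (toℕ l)))

sumFin-toℕ : ∀ m (q : ℕ → ℤ) → sumFin m (λ l → q (toℕ l)) ≡ sumBelow m q
sumFin-toℕ zero    q = refl
sumFin-toℕ (suc m) q = cong (_+_ (q 0)) (sumFin-toℕ m (q ∘ suc))

-- Generating functions

rowSums-⊛-P : ∀ n (i : Fin (suc n)) → rowSums (suc n) i ⊛ P (suc n) ≈ Pℤ (level (suc n) (toℕ i))
rowSums-⊛-P n i zero    = trans (cong (_* 1ℤ) (rowSums-zero (suc n) i)) (sym (Pℤ-constant (level (suc n) (toℕ i))))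
rowSums-⊛-P n i (suc k) = begin
  sumTo (suc k) (λ j → G i j * p (suc k ∸ j))
    ≡⟨ sumTo-suc k _ ⟩
  G i 0 * p (suc k) + sumTo k (λ j → G i (suc j) * p (k ∸ j))
    ≡⟨ cong₂ _+_ (trans (cong (_* p (suc k)) (rowSums-zero m i)) (ℤₚ.*-identityˡ _))
                 (sumTo-cong k (λ j _ → unfold j)) ⟩
  p (suc k) + sumTo k (λ j → sumFin m (λ l → A m i l * (G l j * p (k ∸ j))))
    ≡⟨ cong (_+_ (p (suc k))) (sumTo-sumFin-comm k m (λ j l → A m i l * (G l j * p (k ∸ j)))) ⟩
  p (suc k) + sumFin m (λ l → sumTo k (λ j → A m i l * (G l j * p (k ∸ j))))
    ≡⟨ cong (_+_ (p (suc k))) (sumFin-cong m (λ l →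
         trans (sym (*-distribˡ-sumTo k (A m i l) (λ j → G l j * p (k ∸ j)))) (cong (A m i l *_) (rowSums-⊛-P n l k)))) ⟩
  p (suc k) + sumFin m (λ l → A m i l * Pℤ (level m (toℕ l)) k)
    ≡⟨ cong (_+_ (p (suc k))) (sumFin-A-row n i (λ c → Pℤ (level m c) k)) ⟩
  p (suc k) + sumBelow (suc (n ∸ toℕ i)) (λ c → Pℤ (level m c) k)
    ≡⟨ P-telescope (suc (n ∸ toℕ i)) (toℕ i) k (cong suc (ℕₚ.m∸n+n≡m (ℕₚ.≤-pred (toℕ<n i)))) ⟩
  Pℤ (level m (toℕ i)) (suc k) ∎
  where
  open ≡-Reasoning
  m = suc n
  G = rowSums m
  p = P m
  unfold : ∀ j → G i (suc j) * p (k ∸ j) ≡ sumFin m (λ l → A m i l * (G l j * p (k ∸ j)))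
  unfold j = begin
    G i (suc j) * p (k ∸ j)
      ≡⟨ cong (_* p (k ∸ j)) (rowSums-suc m i j) ⟩
    sumFin m (λ l → A m i l * G l j) * p (k ∸ j)
      ≡⟨ *-distribʳ-sumFin m (p (k ∸ j)) (λ l → A m i l * G l j) ⟩
    sumFin m (λ l → A m i l * G l j * p (k ∸ j))
      ≡⟨ sumFin-cong m (λ l → ℤₚ.*-assoc (A m i l) (G l j) (p (k ∸ j))) ⟩
    sumFin m (λ l → A m i l * (G l j * p (k ∸ j))) ∎

F-⊛-P : ∀ n → F n ⊛ P (suc n) ≈ negX (P n)
F-⊛-P n zero    = refl
F-⊛-P n (suc k) = begin
  sumTo (suc k) (λ j → F n j * p (suc k ∸ j))
    ≡⟨ sumTo-suc k _ ⟩
  1ℤ * p (suc k) + sumTo k (λ j → sumFin m (λ i → rowSums m i j) * p (k ∸ j))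
    ≡⟨ cong₂ _+_ (ℤₚ.*-identityˡ (p (suc k))) (sumTo-cong k (λ j _ → *-distribʳ-sumFin m (p (k ∸ j)) (λ i → rowSums m i j))) ⟩
  p (suc k) + sumTo k (λ j → sumFin m (λ i → rowSums m i j * p (k ∸ j)))
    ≡⟨ cong (_+_ (p (suc k))) (sumTo-sumFin-comm k m (λ j i → rowSums m i j * p (k ∸ j))) ⟩
  p (suc k) + sumFin m (λ i → (rowSums m i ⊛ p) k)
    ≡⟨ cong (_+_ (p (suc k))) (sumFin-cong m (λ i → rowSums-⊛-P n i k)) ⟩
  p (suc k) + sumFin m (λ i → Pℤ (level m (toℕ i)) k)
    ≡⟨ cong (_+_ (p (suc k))) (sumFin-toℕ m (λ c → Pℤ (level m c) k)) ⟩
  p (suc k) + sumBelow m (λ c → Pℤ (level m c) k)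
    ≡⟨ P-telescope m 0 k (ℕₚ.+-identityʳ m) ⟩
  Pℤ (level m 0) (suc k) ∎
  where
  open ≡-Reasoning
  m = suc n
  p = P m

-- Multiplying by P_{n+1}(-x) reduces the claim to F(n+1,x) P_{n+2}(x) = P_{n+1}(-x),
-- because P_{n+1}(-x) (-x + F(n,-x)) = P_n(x) - x P_{n+1}(-x) = P_{n+2}(x).
F-⊛-minusX+ : ∀ n → F (suc n) ⊛ minusX+ (negX (F n)) ≈ oneS
F-⊛-minusX+ n = ⊛-idempotent⇒oneS {c = c} refl c⊛[fh]≈c
  where
  c f h : FPS
  c = negX (P (suc n))
  f = F (suc n)
  h = minusX+ (negX (F n))
  c⊛negX[F] : c ⊛ negX (F n) ≈ P n
  c⊛negX[F] k = begin
    (c ⊛ negX (F n)) k              ≡⟨ negX-⊛ (P (suc n)) (F n) k ⟨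
    negX (P (suc n) ⊛ F n) k        ≡⟨ cong (-1ℤ ^ k *_) (trans (⊛-comm (P (suc n)) (F n) k) (F-⊛-P n k)) ⟩
    negX (negX (P n)) k             ≡⟨ negX-involutive (P n) k ⟩
    P n k                           ∎
    where open ≡-Reasoning
  c⊛h≈P : c ⊛ h ≈ P (suc (suc n))
  c⊛h≈P k = trans (⊛-congʳ c (minusX+≈⊖X (negX (F n))) k)
                  (trans (⊛-distribˡ-⊖ c (negX (F n)) X k) (coefficient k))
    where
    coefficient : ∀ k → (c ⊛ negX (F n)) k - (c ⊛ X) k ≡ P (suc (suc n)) k
    coefficient zero    = cong₂ _-_ (c⊛negX[F] 0) (⊛-X-zero c)
    coefficient (suc k) = trans (cong₂ _-_ (c⊛negX[F] (suc k)) (⊛-X-suc c k)) (sym (P-recurrence n k))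
  c⊛[fh]≈c : c ⊛ (f ⊛ h) ≈ c
  c⊛[fh]≈c k = begin
    (c ⊛ (f ⊛ h)) k     ≡⟨ ⊛-assoc c f h k ⟨
    ((c ⊛ f) ⊛ h) k     ≡⟨ ⊛-congˡ h (⊛-comm c f) k ⟩
    ((f ⊛ c) ⊛ h) k     ≡⟨ ⊛-assoc f c h k ⟩
    (f ⊛ (c ⊛ h)) k     ≡⟨ ⊛-congʳ f c⊛h≈P k ⟩
    (f ⊛ P (suc (suc n))) k ≡⟨ F-⊛-P (suc n) k ⟩
    c k                 ∎
    where open ≡-Reasoning

theorem4p18 : ((n : ℕ) → (k : ℕ) → (F n ⊛ P (suc n)) k ≡ negX (P n) k)
            × ((n : ℕ) → (k : ℕ) → (F (suc n) ⊛ minusX+ (negX (F n))) k ≡ oneS k)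
theorem4p18 = F-⊛-P , F-⊛-minusX+
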